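{- Let $m,n$ be positive integers with $mn$ even. If there are triangle designs in $\mathbb{F}_2^m$ and in $\mathbb{F}_2^n$, then there is a triangle design in $\mathbb{F}_2^{m+n}$.
   Context: For a vector space $V$ over $\mathbb{F}_2$, a triangle is a set $\{\langle a,b\rangle,\langle b,c\rangle,\langle c,a\rangle\}$ of three $2$-dimensional subspaces, with $a,b,c$ linearly independent. A triangle design in $V$ is a set of triangles such that every $2$-dimensional subspace of $V$ belongs to exactly one triangle of the set (for $\dim V=1$ the empty set is a triangle design). -}

module Defs where

open import Data.Bool using (Bool; true; false; _xor_; _∧_)
open import Data.Vec using (Vec; zipWith; replicate; map)
open import Data.Nat using (ℕ)
open import Data.Fin using (Fin)
open import Data.Product using (Σ; ∃; _×_; _,_)
open import Data.Sum using (_⊎_)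
open import Relation.Binary.PropositionalEquality using (_≡_)
open import Function.Bundles using (_⇔_)

V : ℕ → Set
V n = Vec Bool n

_⊕_ : ∀ {n} → V n → V n → V n
_⊕_ = zipWith _xor_

_·_ : ∀ {n} → Bool → V n → V n
x · v = map (x ∧_) v

𝟎 : ∀ {n} → V n
𝟎 = replicate _ false

Indep₂ : ∀ {n} → V n → V n → Set
Indep₂ a b = ∀ x y → (x · a) ⊕ (y · b) ≡ 𝟎 → (x ≡ false × y ≡ false)

Indep₃ : ∀ {n} → V n → V n → V n → Set
Indep₃ a b c = ∀ x y z → ((x · a) ⊕ (y · b)) ⊕ (z · c) ≡ 𝟎
  → (x ≡ false × y ≡ false × z ≡ false)

_∈⟨_,_⟩ : ∀ {n} → V n → V n → V n → Set
v ∈⟨ a , b ⟩ = ∃ λ x → ∃ λ y → v ≡ (x · a) ⊕ (y · b)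

-- A 2-dimensional subspace, presented by a basis; subspaces are compared
-- as subsets (two bases give the same subspace iff their spans coincide).
record Sub2 (n : ℕ) : Set where
  constructor sub2
  field
    u w   : V n
    indep : Indep₂ u w

_≈S_ : ∀ {n} → Sub2 n → Sub2 n → Set
U ≈S W = ∀ v → (v ∈⟨ Sub2.u U , Sub2.w U ⟩) ⇔ (v ∈⟨ Sub2.u W , Sub2.w W ⟩)

-- A triangle {⟨a,b⟩, ⟨b,c⟩, ⟨c,a⟩} with a, b, c linearly independent.
record Triangle (n : ℕ) : Set where
  constructor tri
  field
    a b c : V n
    indep : Indep₃ a b c

_∈T_ : ∀ {n} → Sub2 n → Triangle n → Set
U ∈T T =
  (∀ v → (v ∈⟨ Sub2.u U , Sub2.w U ⟩) ⇔ (v ∈⟨ Triangle.a T , Triangle.b T ⟩))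
  ⊎ ((∀ v → (v ∈⟨ Sub2.u U , Sub2.w U ⟩) ⇔ (v ∈⟨ Triangle.b T , Triangle.c T ⟩))
  ⊎ (∀ v → (v ∈⟨ Sub2.u U , Sub2.w U ⟩) ⇔ (v ∈⟨ Triangle.c T , Triangle.a T ⟩)))

-- A (finite) family of triangles T₀,…,T_{k-1} in which every 2-dimensional
-- subspace lies in exactly one member. (Repeated triangles are thereby
-- excluded, so this is exactly a set of triangles with the design property.)
IsTriangleDesign : ∀ {n k} → (Fin k → Triangle n) → Set
IsTriangleDesign {n} {k} T =
  ∀ (U : Sub2 n) → (∃ λ i → U ∈T T i) × (∀ i j → U ∈T T i → U ∈T T j → i ≡ j)

HasTriangleDesign : ℕ → Set
HasTriangleDesign n = ∃ λ k → Σ (Fin k → Triangle n) IsTriangleDesign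

-- Write F₂ᵐ⁺ⁿ = F₂ᵐ ⊕ F₂ⁿ with m even (the statement is symmetric) and sort its lines, i.e. its
-- 2-dimensional subspaces U, by their projection π U to F₂ⁿ.  If π U = 0, U is a line of F₂ᵐ and is
-- covered by the design of F₂ᵐ.  If π U is a line, it lies in a unique triangle {a , b , c} of the design
-- of F₂ⁿ, and U lies in exactly one of the lifted triangles {(s , a) , (t , b) , (s + t , c)}, s , t ∈ F₂ᵐ.
-- If π U = ⟨ b ⟩, then U is a line of F₂ᵐ ⊕ ⟨ b ⟩ ≅ F₂ᵐ⁺¹ not contained in F₂ᵐ.  So it remains to
-- partition the lines of F₂ᵐ⁺¹ off the hyperplane F₂ᵐ into triangles, for every even m.  For m = 0 there
-- are none, for m = 2 two triangles of the Fano plane do it, and the same splitting, applied to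
-- F₂ᵈ⁺³ = F₂² ⊕ F₂ᵈ⁺¹, reduces m = d + 2 to the cases d and 2.

module Submission where

open import Defs
open import Data.Nat using (ℕ; zero; suc; _+_; _*_; _≥_)
open import Data.Nat.Divisibility using (_∣_; divides)
open import Data.Nat.Primality using (euclidsLemma; prime[2])
open import Data.Nat.Properties using (+-comm)
open import Data.Bool using (Bool; true; false; _xor_; _∧_)
open import Data.Bool.Properties
  using ( xor-comm; xor-assoc; xor-identityˡ; xor-identityʳ; xor-same
        ; ∧-distribˡ-xor; ∧-distribʳ-xor; ∧-assoc; ∧-zeroʳ; ∧-comm; ∧-identityʳ )
  renaming (_≟_ to _≟ᵇ_)
open import Data.Vec using ([]; _∷_; replicate; _++_; take; drop)
open import Data.Vec.Properties
  using ( zipWith-comm; zipWith-assoc; zipWith-identityˡ; zipWith-identityʳ; zipWith-++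
        ; map-++; map-id; map-const; map-replicate; take-zipWith; drop-zipWith; take-map; drop-map
        ; take++drop≡id; ++-injective; ++-injectiveˡ; ++-injectiveʳ; ∷-injectiveʳ; ≡-dec )
open import Data.Fin using (Fin)
import Data.Fin as Fin
open import Data.Fin.Properties using (0↔⊥; 2↔Bool; +↔⊎; *↔×)
open import Data.Product using (Σ; ∃; _×_; _,_; proj₁; proj₂)
import Data.Product as Prod
open import Data.Sum using (_⊎_; inj₁; inj₂)
import Data.Sum as Sum
open import Data.Empty using (⊥; ⊥-elim)
open import Data.Unit using (⊤; tt)
open import Function using (id; _∘_)
open import Function.Bundles using (_⇔_; mk⇔; Equivalence; _↔_; Inverse; mk↔ₛ′)
open import Function.Properties.Inverse using (↔-refl; ↔-sym; ↔-trans)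
open import Data.Sum.Function.Propositional using (_⊎-↔_)
open import Data.Product.Function.NonDependent.Propositional using (_×-↔_)
open import Algebra.Bundles using (CommutativeMonoid)
open import Algebra.Structures using (IsCommutativeMonoid)
import Algebra.Properties.CommutativeSemigroup as CommutativeSemigroupProperties
open import Relation.Nullary using (Dec; yes; no; ¬_)
open import Relation.Nullary.Decidable using (_×-dec_; _⊎-dec_; _→-dec_; map′; from-yes; True; toWitness)
open import Relation.Binary using (DecidableEquality)
open import Relation.Binary.PropositionalEquality
  using (_≡_; _≢_; refl; sym; trans; cong; cong₂; subst; subst₂; module ≡-Reasoning)
open import Relation.Binary.PropositionalEquality.Algebra using (isMagma)

module _ {n : ℕ} where

  ⊕-comm : (a b : V n) → a ⊕ b ≡ b ⊕ a
  ⊕-comm = zipWith-comm xor-comm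

  ⊕-assoc : (a b c : V n) → (a ⊕ b) ⊕ c ≡ a ⊕ (b ⊕ c)
  ⊕-assoc = zipWith-assoc xor-assoc

  ⊕-identityˡ : (a : V n) → 𝟎 ⊕ a ≡ a
  ⊕-identityˡ = zipWith-identityˡ xor-identityˡ

  ⊕-identityʳ : (a : V n) → a ⊕ 𝟎 ≡ a
  ⊕-identityʳ = zipWith-identityʳ xor-identityʳ

  ⊕-isCommutativeMonoid : IsCommutativeMonoid _≡_ (_⊕_ {n}) 𝟎
  ⊕-isCommutativeMonoid = record
    { isMonoid = record
      { isSemigroup = record { isMagma = isMagma _⊕_ ; assoc = ⊕-assoc }
      ; identity = ⊕-identityˡ , ⊕-identityʳ }
    ; comm = ⊕-comm }

⊕-commutativeMonoid : ℕ → CommutativeMonoid _ _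
⊕-commutativeMonoid n = record { isCommutativeMonoid = ⊕-isCommutativeMonoid {n} }

module _ {n : ℕ} where
  open CommutativeSemigroupProperties (CommutativeMonoid.commutativeSemigroup (⊕-commutativeMonoid n)) public
    using () renaming (interchange to ⊕-interchange)

⊕-self : ∀ {n} (a : V n) → a ⊕ a ≡ 𝟎
⊕-self []      = refl
⊕-self (x ∷ a) = cong₂ _∷_ (xor-same x) (⊕-self a)

·-identity : ∀ {n} (a : V n) → true · a ≡ a
·-identity = map-id

·-zeroˡ : ∀ {n} (a : V n) → false · a ≡ 𝟎
·-zeroˡ a = map-const a false

·-zeroʳ : ∀ {n} (x : Bool) → x · 𝟎 {n} ≡ 𝟎
·-zeroʳ {n} x = trans (map-replicate (x ∧_) false n) (cong (replicate n) (∧-zeroʳ x))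

·-distribˡ-⊕ : ∀ {n} (x : Bool) (a b : V n) → x · (a ⊕ b) ≡ (x · a) ⊕ (x · b)
·-distribˡ-⊕ x []      []      = refl
·-distribˡ-⊕ x (r ∷ a) (s ∷ b) = cong₂ _∷_ (∧-distribˡ-xor x r s) (·-distribˡ-⊕ x a b)

·-distribʳ-xor : ∀ {n} (x y : Bool) (a : V n) → (x xor y) · a ≡ (x · a) ⊕ (y · a)
·-distribʳ-xor x y []      = refl
·-distribʳ-xor x y (r ∷ a) = cong₂ _∷_ (∧-distribʳ-xor r x y) (·-distribʳ-xor x y a)

·-assoc : ∀ {n} (x y : Bool) (a : V n) → x · (y · a) ≡ (x ∧ y) · a
·-assoc x y []      = refl
·-assoc x y (r ∷ a) = cong₂ _∷_ (sym (∧-assoc x y r)) (·-assoc x y a)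

⊕-cancelʳ : ∀ {n} (a b : V n) → (a ⊕ b) ⊕ b ≡ a
⊕-cancelʳ a b = trans (⊕-assoc a b b) (trans (cong (a ⊕_) (⊕-self b)) (⊕-identityʳ a))

⊕-cancelˡ : ∀ {n} (a b : V n) → a ⊕ (a ⊕ b) ≡ b
⊕-cancelˡ a b = trans (sym (⊕-assoc a a b)) (trans (cong (_⊕ b) (⊕-self a)) (⊕-identityˡ b))

⊕≡𝟎⇒≡ : ∀ {n} (a b : V n) → a ⊕ b ≡ 𝟎 → a ≡ b
⊕≡𝟎⇒≡ a b e = trans (sym (⊕-cancelʳ a b)) (trans (cong (_⊕ b) e) (⊕-identityˡ b))

⊕-injectiveˡ : ∀ {n} {a b : V n} c → a ⊕ c ≡ b ⊕ c → a ≡ b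
⊕-injectiveˡ {a = a} {b} c e = trans (sym (⊕-cancelʳ a c)) (trans (cong (_⊕ c) e) (⊕-cancelʳ b c))

⊕-injectiveʳ : ∀ {n} {a b : V n} c → c ⊕ a ≡ c ⊕ b → a ≡ b
⊕-injectiveʳ {a = a} {b} c e = trans (sym (⊕-cancelˡ c a)) (trans (cong (c ⊕_) e) (⊕-cancelˡ c b))

lincomb-10 : ∀ {n} (a b : V n) → (true · a) ⊕ (false · b) ≡ a
lincomb-10 a b = trans (cong₂ _⊕_ (·-identity a) (·-zeroˡ b)) (⊕-identityʳ a)

lincomb-01 : ∀ {n} (a b : V n) → (false · a) ⊕ (true · b) ≡ b
lincomb-01 a b = trans (cong₂ _⊕_ (·-zeroˡ a) (·-identity b)) (⊕-identityˡ b)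

lincomb-00 : ∀ {n} (a b : V n) → (false · a) ⊕ (false · b) ≡ 𝟎
lincomb-00 a b = trans (cong₂ _⊕_ (·-zeroˡ a) (·-zeroˡ b)) (⊕-identityˡ 𝟎)

lincomb-⊕ : ∀ {n} (x y x′ y′ : Bool) (a b : V n) →
  ((x · a) ⊕ (y · b)) ⊕ ((x′ · a) ⊕ (y′ · b)) ≡ ((x xor x′) · a) ⊕ ((y xor y′) · b)
lincomb-⊕ x y x′ y′ a b = trans (⊕-interchange (x · a) (y · b) (x′ · a) (y′ · b))
  (sym (cong₂ _⊕_ (·-distribʳ-xor x x′ a) (·-distribʳ-xor y y′ b)))

lincomb-lincomb : ∀ {n} (x y x₁ y₁ x₂ y₂ : Bool) (a b : V n) →
  (x · ((x₁ · a) ⊕ (y₁ · b))) ⊕ (y · ((x₂ · a) ⊕ (y₂ · b)))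
    ≡ (((x ∧ x₁) xor (y ∧ x₂)) · a) ⊕ (((x ∧ y₁) xor (y ∧ y₂)) · b)
lincomb-lincomb x y x₁ y₁ x₂ y₂ a b = begin
  (x · ((x₁ · a) ⊕ (y₁ · b))) ⊕ (y · ((x₂ · a) ⊕ (y₂ · b)))
    ≡⟨ cong₂ _⊕_ (·-distribˡ-⊕ x (x₁ · a) (y₁ · b)) (·-distribˡ-⊕ y (x₂ · a) (y₂ · b)) ⟩
  ((x · (x₁ · a)) ⊕ (x · (y₁ · b))) ⊕ ((y · (x₂ · a)) ⊕ (y · (y₂ · b)))
    ≡⟨ cong₂ _⊕_ (cong₂ _⊕_ (·-assoc x x₁ a) (·-assoc x y₁ b)) (cong₂ _⊕_ (·-assoc y x₂ a) (·-assoc y y₂ b)) ⟩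
  (((x ∧ x₁) · a) ⊕ ((x ∧ y₁) · b)) ⊕ (((y ∧ x₂) · a) ⊕ ((y ∧ y₂) · b))
    ≡⟨ lincomb-⊕ (x ∧ x₁) (x ∧ y₁) (y ∧ x₂) (y ∧ y₂) a b ⟩
  (((x ∧ x₁) xor (y ∧ x₂)) · a) ⊕ (((x ∧ y₁) xor (y ∧ y₂)) · b) ∎
  where open ≡-Reasoning

++-lincomb : ∀ {m n} (x y : Bool) (a c : V m) (b d : V n) →
  (x · (a ++ b)) ⊕ (y · (c ++ d)) ≡ ((x · a) ⊕ (y · c)) ++ ((x · b) ⊕ (y · d))
++-lincomb x y a c b d =
  trans (cong₂ _⊕_ (map-++ (x ∧_) a b) (map-++ (y ∧_) c d)) (zipWith-++ _xor_ (x · a) (x · b) (y · c) (y · d))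

_≟ᵥ_ : ∀ {n} → DecidableEquality (V n)
_≟ᵥ_ = ≡-dec _≟ᵇ_

take-drop-++ : ∀ {m n} (a : V m) (b : V n) → take m (a ++ b) ≡ a × drop m (a ++ b) ≡ b
take-drop-++ {m} a b = ++-injective (take m (a ++ b)) a (take++drop≡id m (a ++ b))

drop-++ : ∀ {m n} (a : V m) (b : V n) → drop m (a ++ b) ≡ b
drop-++ a b = proj₂ (take-drop-++ a b)

module _ {n : ℕ} where

  ⟨_,_⟩≈⟨_,_⟩ : V n → V n → V n → V n → Set
  ⟨ u , w ⟩≈⟨ a , b ⟩ = ∀ v → (v ∈⟨ u , w ⟩) ⇔ (v ∈⟨ a , b ⟩)

  -- sub2 u w _ ∈T tri a b c unfolds to ⟨ u , w ⟩∈△⟨ a , b , c ⟩.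
  ⟨_,_⟩∈△⟨_,_,_⟩ : V n → V n → V n → V n → V n → Set
  ⟨ u , w ⟩∈△⟨ a , b , c ⟩ = ⟨ u , w ⟩≈⟨ a , b ⟩ ⊎ (⟨ u , w ⟩≈⟨ b , c ⟩ ⊎ ⟨ u , w ⟩≈⟨ c , a ⟩)

module _ {n : ℕ} {a b : V n} where

  ∈⟨⟩-left : a ∈⟨ a , b ⟩
  ∈⟨⟩-left = true , false , sym (lincomb-10 a b)

  ∈⟨⟩-right : b ∈⟨ a , b ⟩
  ∈⟨⟩-right = false , true , sym (lincomb-01 a b)

  ∈⟨⟩-lincomb : ∀ {p q} x y → p ∈⟨ a , b ⟩ → q ∈⟨ a , b ⟩ → ((x · p) ⊕ (y · q)) ∈⟨ a , b ⟩
  ∈⟨⟩-lincomb x y (x₁ , y₁ , refl) (x₂ , y₂ , refl) = _ , _ , lincomb-lincomb x y x₁ y₁ x₂ y₂ a b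

  ⟨⟩-⊆ : ∀ {p q v} → p ∈⟨ a , b ⟩ → q ∈⟨ a , b ⟩ → v ∈⟨ p , q ⟩ → v ∈⟨ a , b ⟩
  ⟨⟩-⊆ p∈ q∈ (x , y , refl) = ∈⟨⟩-lincomb x y p∈ q∈

module _ {n : ℕ} {u w a b : V n} where

  ≈-intro : u ∈⟨ a , b ⟩ → w ∈⟨ a , b ⟩ → a ∈⟨ u , w ⟩ → b ∈⟨ u , w ⟩ → ⟨ u , w ⟩≈⟨ a , b ⟩
  ≈-intro u∈ w∈ a∈ b∈ v = mk⇔ (⟨⟩-⊆ u∈ w∈) (⟨⟩-⊆ a∈ b∈)

  ≈⇒∈ : ⟨ u , w ⟩≈⟨ a , b ⟩ → u ∈⟨ a , b ⟩ × w ∈⟨ a , b ⟩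
  ≈⇒∈ S = Equivalence.to (S u) ∈⟨⟩-left , Equivalence.to (S w) ∈⟨⟩-right

  ≈-sym : ⟨ u , w ⟩≈⟨ a , b ⟩ → ⟨ a , b ⟩≈⟨ u , w ⟩
  ≈-sym S v = mk⇔ (Equivalence.from (S v)) (Equivalence.to (S v))

≈-trans : ∀ {n} {u w a b c d : V n} → ⟨ u , w ⟩≈⟨ a , b ⟩ → ⟨ a , b ⟩≈⟨ c , d ⟩ → ⟨ u , w ⟩≈⟨ c , d ⟩
≈-trans S T v = mk⇔ (Equivalence.to (T v) ∘ Equivalence.to (S v)) (Equivalence.from (S v) ∘ Equivalence.from (T v))

≈-swap : ∀ {n} {u w : V n} → ⟨ u , w ⟩≈⟨ w , u ⟩
≈-swap = ≈-intro ∈⟨⟩-right ∈⟨⟩-left ∈⟨⟩-right ∈⟨⟩-left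

module _ {n : ℕ} {a b : V n} where

  Indep₂⇒≢𝟎ˡ : Indep₂ a b → a ≢ 𝟎
  Indep₂⇒≢𝟎ˡ ind a≡𝟎 with ind true false (trans (lincomb-10 a b) a≡𝟎)
  ... | ()

  Indep₂⇒≢𝟎ʳ : Indep₂ a b → b ≢ 𝟎
  Indep₂⇒≢𝟎ʳ ind b≡𝟎 with ind false true (trans (lincomb-01 a b) b≡𝟎)
  ... | ()

  Indep₂⇒≢ : Indep₂ a b → a ≢ b
  Indep₂⇒≢ ind a≡b
    with ind true true (trans (cong₂ _⊕_ (·-identity a) (·-identity b)) (trans (cong (a ⊕_) (sym a≡b)) (⊕-self a)))
  ... | ()

  ≢⇒Indep₂ : a ≢ 𝟎 → b ≢ 𝟎 → a ≢ b → Indep₂ a b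
  ≢⇒Indep₂ a≢𝟎 b≢𝟎 a≢b true  true  e =
    ⊥-elim (a≢b (⊕≡𝟎⇒≡ a b (trans (sym (cong₂ _⊕_ (·-identity a) (·-identity b))) e)))
  ≢⇒Indep₂ a≢𝟎 b≢𝟎 a≢b true  false e = ⊥-elim (a≢𝟎 (trans (sym (lincomb-10 a b)) e))
  ≢⇒Indep₂ a≢𝟎 b≢𝟎 a≢b false true  e = ⊥-elim (b≢𝟎 (trans (sym (lincomb-01 a b)) e))
  ≢⇒Indep₂ a≢𝟎 b≢𝟎 a≢b false false e = refl , refl

  Indep₂-coefficients : ∀ {x y x′ y′} → Indep₂ a b → (x · a) ⊕ (y · b) ≡ (x′ · a) ⊕ (y′ · b) → x ≡ x′ × y ≡ y′
  Indep₂-coefficients {x} {y} {x′} {y′} ind e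
    with ind (x xor x′) (y xor y′) (trans (sym (lincomb-⊕ x y x′ y′ a b)) (trans (cong (_⊕ _) e) (⊕-self _)))
  ... | p , q = xor≡false⇒≡ x x′ p , xor≡false⇒≡ y y′ q
    where
    xor≡false⇒≡ : ∀ s t → s xor t ≡ false → s ≡ t
    xor≡false⇒≡ false false _ = refl
    xor≡false⇒≡ true  true  _ = refl

Indep₂-sym : ∀ {n} {a b : V n} → Indep₂ a b → Indep₂ b a
Indep₂-sym ind = ≢⇒Indep₂ (Indep₂⇒≢𝟎ʳ ind) (Indep₂⇒≢𝟎ˡ ind) (Indep₂⇒≢ ind ∘ sym)

∧-xor-swap : ∀ s t → (s ∧ t) xor (t ∧ s) ≡ false
∧-xor-swap s t = trans (cong ((s ∧ t) xor_) (∧-comm t s)) (xor-same (s ∧ t))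

-- Cramer's rule over F₂: for p = x₁u + y₁w and q = x₂u + y₂w the adjugate matrix gives det · u and
-- det · w as combinations of p and q, and independence of p and q forces det = 1.
module _ {n : ℕ} (u w : V n) (x₁ y₁ x₂ y₂ : Bool) where

  adjugate₁ : (y₂ · ((x₁ · u) ⊕ (y₁ · w))) ⊕ (y₁ · ((x₂ · u) ⊕ (y₂ · w))) ≡ ((y₂ ∧ x₁) xor (y₁ ∧ x₂)) · u
  adjugate₁ = begin
    (y₂ · ((x₁ · u) ⊕ (y₁ · w))) ⊕ (y₁ · ((x₂ · u) ⊕ (y₂ · w)))
      ≡⟨ lincomb-lincomb y₂ y₁ x₁ y₁ x₂ y₂ u w ⟩
    (((y₂ ∧ x₁) xor (y₁ ∧ x₂)) · u) ⊕ (((y₂ ∧ y₁) xor (y₁ ∧ y₂)) · w)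
      ≡⟨ cong (λ t → (((y₂ ∧ x₁) xor (y₁ ∧ x₂)) · u) ⊕ (t · w)) (∧-xor-swap y₂ y₁) ⟩
    (((y₂ ∧ x₁) xor (y₁ ∧ x₂)) · u) ⊕ (false · w)
      ≡⟨ trans (cong (_ ⊕_) (·-zeroˡ w)) (⊕-identityʳ _) ⟩
    ((y₂ ∧ x₁) xor (y₁ ∧ x₂)) · u ∎
    where open ≡-Reasoning

  adjugate₂ : (x₂ · ((x₁ · u) ⊕ (y₁ · w))) ⊕ (x₁ · ((x₂ · u) ⊕ (y₂ · w))) ≡ ((y₂ ∧ x₁) xor (y₁ ∧ x₂)) · w
  adjugate₂ = begin
    (x₂ · ((x₁ · u) ⊕ (y₁ · w))) ⊕ (x₁ · ((x₂ · u) ⊕ (y₂ · w)))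
      ≡⟨ lincomb-lincomb x₂ x₁ x₁ y₁ x₂ y₂ u w ⟩
    (((x₂ ∧ x₁) xor (x₁ ∧ x₂)) · u) ⊕ (((x₂ ∧ y₁) xor (x₁ ∧ y₂)) · w)
      ≡⟨ cong₂ (λ s t → (s · u) ⊕ (t · w)) (∧-xor-swap x₂ x₁)
               (trans (xor-comm (x₂ ∧ y₁) (x₁ ∧ y₂)) (cong₂ _xor_ (∧-comm x₁ y₂) (∧-comm x₂ y₁))) ⟩
    (false · u) ⊕ (((y₂ ∧ x₁) xor (y₁ ∧ x₂)) · w)
      ≡⟨ trans (cong (_⊕ _) (·-zeroˡ u)) (⊕-identityˡ _) ⟩
    ((y₂ ∧ x₁) xor (y₁ ∧ x₂)) · w ∎
    where open ≡-Reasoning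

Indep₂⇒det≡true : ∀ {n} {u w : V n} x₁ y₁ x₂ y₂ →
  Indep₂ ((x₁ · u) ⊕ (y₁ · w)) ((x₂ · u) ⊕ (y₂ · w)) → (y₂ ∧ x₁) xor (y₁ ∧ x₂) ≡ true
Indep₂⇒det≡true {u = u} {w} x₁ y₁ x₂ y₂ ind with (y₂ ∧ x₁) xor (y₁ ∧ x₂) in det≡
... | true  = refl
... | false
  with ind y₂ y₁ (trans (adjugate₁ u w x₁ y₁ x₂ y₂) (trans (cong (_· u) det≡) (·-zeroˡ u)))
     | ind x₂ x₁ (trans (adjugate₂ u w x₁ y₁ x₂ y₂) (trans (cong (_· w) det≡) (·-zeroˡ w)))
...  | refl , refl | refl , refl = ⊥-elim (Indep₂⇒≢𝟎ˡ ind (lincomb-00 u w))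

Indep₂⇒≈ : ∀ {n} {u w p q : V n} → p ∈⟨ u , w ⟩ → q ∈⟨ u , w ⟩ → Indep₂ p q → ⟨ u , w ⟩≈⟨ p , q ⟩
Indep₂⇒≈ {u = u} {w} p∈@(x₁ , y₁ , refl) q∈@(x₂ , y₂ , refl) ind =
  ≈-intro (y₂ , y₁ , sym (trans (adjugate₁ u w x₁ y₁ x₂ y₂) (det≡true▹ u)))
          (x₂ , x₁ , sym (trans (adjugate₂ u w x₁ y₁ x₂ y₂) (det≡true▹ w))) p∈ q∈
  where
  det≡true▹ : ∀ v → ((y₂ ∧ x₁) xor (y₁ ∧ x₂)) · v ≡ v
  det≡true▹ v = trans (cong (_· v) (Indep₂⇒det≡true x₁ y₁ x₂ y₂ ind)) (·-identity v)

¬Indep₂-multiples : ∀ {n} {r : V n} x y → ¬ Indep₂ (x · r) (y · r)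
¬Indep₂-multiples {r = r} false y     ind = Indep₂⇒≢𝟎ˡ ind (·-zeroˡ r)
¬Indep₂-multiples {r = r} true  false ind = Indep₂⇒≢𝟎ʳ ind (·-zeroˡ r)
¬Indep₂-multiples         true  true  ind = Indep₂⇒≢ ind refl

module _ {n : ℕ} {u w a b : V n} where

  private
    ¬Indep₂-in-cyclic : ∀ r → (∀ x y → ∃ λ z → (x · u) ⊕ (y · w) ≡ z · r) →
      a ∈⟨ u , w ⟩ → b ∈⟨ u , w ⟩ → ¬ Indep₂ a b
    ¬Indep₂-in-cyclic r cyclic (x₁ , y₁ , refl) (x₂ , y₂ , refl) ind with cyclic x₁ y₁ | cyclic x₂ y₂
    ... | z₁ , e₁ | z₂ , e₂ = ¬Indep₂-multiples z₁ z₂ (subst₂ Indep₂ e₁ e₂ ind)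

  Indep₂-resp-≈ : ⟨ u , w ⟩≈⟨ a , b ⟩ → Indep₂ a b → Indep₂ u w
  Indep₂-resp-≈ S ind = ≢⇒Indep₂ u≢𝟎 w≢𝟎 u≢w
    where
    a∈ : a ∈⟨ u , w ⟩
    a∈ = proj₁ (≈⇒∈ (≈-sym S))
    b∈ : b ∈⟨ u , w ⟩
    b∈ = proj₂ (≈⇒∈ (≈-sym S))
    u≢𝟎 : u ≢ 𝟎
    u≢𝟎 u≡𝟎 = ¬Indep₂-in-cyclic w (λ x y → y ,
      trans (cong (λ t → (x · t) ⊕ (y · w)) u≡𝟎) (trans (cong (_⊕ (y · w)) (·-zeroʳ x)) (⊕-identityˡ _))) a∈ b∈ ind
    w≢𝟎 : w ≢ 𝟎
    w≢𝟎 w≡𝟎 = ¬Indep₂-in-cyclic u (λ x y → x ,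
      trans (cong (λ t → (x · u) ⊕ (y · t)) w≡𝟎) (trans (cong ((x · u) ⊕_) (·-zeroʳ y)) (⊕-identityʳ _))) a∈ b∈ ind
    u≢w : u ≢ w
    u≢w u≡w = ¬Indep₂-in-cyclic w (λ x y → x xor y ,
      trans (cong (λ t → (x · t) ⊕ (y · w)) u≡w) (sym (·-distribʳ-xor x y w))) a∈ b∈ ind

module _ {n : ℕ} {a b c : V n} where

  Indep₃-rotate : Indep₃ a b c → Indep₃ b c a
  Indep₃-rotate ind x y z e with ind z x y (trans (⊕-assoc _ _ _) (trans (⊕-comm (z · a) _) e))
  ... | p , q , r = q , r , p

  Indep₃⇒Indep₂ : Indep₃ a b c → Indep₂ a b
  Indep₃⇒Indep₂ ind x y e with ind x y false (trans (cong (_ ⊕_) (·-zeroˡ c)) (trans (⊕-identityʳ _) e))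
  ... | p , q , _ = p , q

  Indep₃⇒∉ : Indep₃ a b c → ¬ c ∈⟨ a , b ⟩
  Indep₃⇒∉ ind (x , y , e) with ind x y true (trans (cong₂ _⊕_ (sym e) (·-identity c)) (⊕-self c))
  ... | _ , _ , ()

  sides-distinct : ∀ {u w} → Indep₃ a b c → ⟨ u , w ⟩≈⟨ a , b ⟩ → ¬ ⟨ u , w ⟩≈⟨ b , c ⟩
  sides-distinct ind S T = Indep₃⇒∉ ind (proj₂ (≈⇒∈ (≈-trans (≈-sym T) S)))

Indep₃⇒Indep₂ᵇᶜ : ∀ {n} {a b c : V n} → Indep₃ a b c → Indep₂ b c
Indep₃⇒Indep₂ᵇᶜ = Indep₃⇒Indep₂ ∘ Indep₃-rotate

Indep₃⇒Indep₂ᶜᵃ : ∀ {n} {a b c : V n} → Indep₃ a b c → Indep₂ c a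
Indep₃⇒Indep₂ᶜᵃ = Indep₃⇒Indep₂ ∘ Indep₃-rotate ∘ Indep₃-rotate

∈△⇒Indep₂ : ∀ {n} {u w a b c : V n} → Indep₃ a b c → ⟨ u , w ⟩∈△⟨ a , b , c ⟩ → Indep₂ u w
∈△⇒Indep₂ ind (inj₁ S)        = Indep₂-resp-≈ S (Indep₃⇒Indep₂ ind)
∈△⇒Indep₂ ind (inj₂ (inj₁ S)) = Indep₂-resp-≈ S (Indep₃⇒Indep₂ᵇᶜ ind)
∈△⇒Indep₂ ind (inj₂ (inj₂ S)) = Indep₂-resp-≈ S (Indep₃⇒Indep₂ᶜᵃ ind)

∈△-map : ∀ {m n} {u w a b c : V m} {u′ w′ a′ b′ c′ : V n} →
  (⟨ u , w ⟩≈⟨ a , b ⟩ → ⟨ u′ , w′ ⟩≈⟨ a′ , b′ ⟩) → (⟨ u , w ⟩≈⟨ b , c ⟩ → ⟨ u′ , w′ ⟩≈⟨ b′ , c′ ⟩) →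
  (⟨ u , w ⟩≈⟨ c , a ⟩ → ⟨ u′ , w′ ⟩≈⟨ c′ , a′ ⟩) → ⟨ u , w ⟩∈△⟨ a , b , c ⟩ → ⟨ u′ , w′ ⟩∈△⟨ a′ , b′ , c′ ⟩
∈△-map f g h = Sum.map f (Sum.map g h)

IsLinear : ∀ {m n} → (V m → V n) → Set
IsLinear f = ∀ x y u w → f ((x · u) ⊕ (y · w)) ≡ (x · f u) ⊕ (y · f w)

module _ {m n : ℕ} {f : V m → V n} (linear : IsLinear f) where

  linear-𝟎 : f 𝟎 ≡ 𝟎
  linear-𝟎 = trans (cong f (sym (lincomb-00 𝟎 𝟎))) (trans (linear false false 𝟎 𝟎) (lincomb-00 _ _))

  linear-· : ∀ x v → f (x · v) ≡ x · f v
  linear-· x v = begin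
    f (x · v)                      ≡⟨ cong f (sym (trans (cong ((x · v) ⊕_) (·-zeroˡ v)) (⊕-identityʳ _))) ⟩
    f ((x · v) ⊕ (false · v))      ≡⟨ linear x false v v ⟩
    (x · f v) ⊕ (false · f v)      ≡⟨ trans (cong ((x · f v) ⊕_) (·-zeroˡ (f v))) (⊕-identityʳ _) ⟩
    x · f v                        ∎
    where open ≡-Reasoning

  linear-lincomb₃ : ∀ x y z a b c →
    f (((x · a) ⊕ (y · b)) ⊕ (z · c)) ≡ ((x · f a) ⊕ (y · f b)) ⊕ (z · f c)
  linear-lincomb₃ x y z a b c = begin
    f (((x · a) ⊕ (y · b)) ⊕ (z · c))        ≡⟨ cong (λ t → f (t ⊕ (z · c))) (sym (·-identity _)) ⟩
    f ((true · ((x · a) ⊕ (y · b))) ⊕ (z · c)) ≡⟨ linear true z _ c ⟩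
    (true · f ((x · a) ⊕ (y · b))) ⊕ (z · f c) ≡⟨ cong (_⊕ (z · f c)) (trans (·-identity _) (linear x y a b)) ⟩
    ((x · f a) ⊕ (y · f b)) ⊕ (z · f c)      ∎
    where open ≡-Reasoning

  linear-∈⟨⟩ : ∀ {v a b} → v ∈⟨ a , b ⟩ → f v ∈⟨ f a , f b ⟩
  linear-∈⟨⟩ {a = a} {b} (x , y , refl) = x , y , linear x y a b

  linear-≈ : ∀ {u w a b} → ⟨ u , w ⟩≈⟨ a , b ⟩ → ⟨ f u , f w ⟩≈⟨ f a , f b ⟩
  linear-≈ S with ≈⇒∈ S | ≈⇒∈ (≈-sym S)
  ... | u∈ , w∈ | a∈ , b∈ = ≈-intro (linear-∈⟨⟩ u∈) (linear-∈⟨⟩ w∈) (linear-∈⟨⟩ a∈) (linear-∈⟨⟩ b∈)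

  linear-reflects-Indep₂ : ∀ {a b} → Indep₂ (f a) (f b) → Indep₂ a b
  linear-reflects-Indep₂ {a} {b} ind x y e = ind x y (trans (sym (linear x y a b)) (trans (cong f e) linear-𝟎))

  linear-reflects-Indep₃ : ∀ {a b c} → Indep₃ (f a) (f b) (f c) → Indep₃ a b c
  linear-reflects-Indep₃ {a} {b} {c} ind x y z e =
    ind x y z (trans (sym (linear-lincomb₃ x y z a b c)) (trans (cong f e) linear-𝟎))

  injective-linear-preserves-Indep₃ : (∀ v → f v ≡ 𝟎 → v ≡ 𝟎) → ∀ {a b c} → Indep₃ a b c → Indep₃ (f a) (f b) (f c)
  injective-linear-preserves-Indep₃ ker≡𝟎 {a} {b} {c} ind x y z e =
    ind x y z (ker≡𝟎 _ (trans (linear-lincomb₃ x y z a b c) e))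

id-linear : ∀ {n} → IsLinear (id {A = V n})
id-linear _ _ _ _ = refl

take-linear : ∀ m {n} → IsLinear (take m {n})
take-linear m x y u w =
  trans (take-zipWith _xor_ (x · u) (y · w)) (cong₂ _⊕_ (take-map (x ∧_) m u) (take-map (y ∧_) m w))

drop-linear : ∀ m {n} → IsLinear (drop m {n})
drop-linear m x y u w =
  trans (drop-zipWith _xor_ (x · u) (y · w)) (cong₂ _⊕_ (drop-map (x ∧_) m u) (drop-map (y ∧_) m w))

_⊞_ : ∀ {m m′ n n′} → (V m → V m′) → (V n → V n′) → V (m + n) → V (m′ + n′)
_⊞_ {m} f g v = f (take m v) ++ g (drop m v)

module _ {m m′ n n′ : ℕ} {f : V m → V m′} {g : V n → V n′} where

  ⊞-linear : IsLinear f → IsLinear g → IsLinear (f ⊞ g)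
  ⊞-linear f-linear g-linear x y u w = begin
    f (take m ((x · u) ⊕ (y · w))) ++ g (drop m ((x · u) ⊕ (y · w)))
      ≡⟨ cong₂ _++_ (trans (cong f (take-linear m x y u w)) (f-linear x y _ _))
                    (trans (cong g (drop-linear m x y u w)) (g-linear x y _ _)) ⟩
    ((x · f (take m u)) ⊕ (y · f (take m w))) ++ ((x · g (drop m u)) ⊕ (y · g (drop m w)))
      ≡⟨ sym (++-lincomb x y (f (take m u)) (f (take m w)) (g (drop m u)) (g (drop m w))) ⟩
    (x · (f ⊞ g) u) ⊕ (y · (f ⊞ g) w) ∎
    where open ≡-Reasoning

  ⊞-inverse : ∀ {f′ : V m′ → V m} {g′ : V n′ → V n} →
    (∀ v → f′ (f v) ≡ v) → (∀ v → g′ (g v) ≡ v) → ∀ v → (f′ ⊞ g′) ((f ⊞ g) v) ≡ v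
  ⊞-inverse {f′} {g′} f′f g′g v with take-drop-++ (f (take m v)) (g (drop m v))
  ... | take≡ , drop≡ =
    trans (cong₂ _++_ (trans (cong f′ take≡) (f′f _)) (trans (cong g′ drop≡) (g′g _))) (take++drop≡id m v)

embed : ∀ {m n} → V m → V (m + n)
embed a = a ++ 𝟎

embed-linear : ∀ {m n} → IsLinear (embed {m} {n})
embed-linear x y u w =
  sym (trans (++-lincomb x y u w 𝟎 𝟎)
             (cong (((x · u) ⊕ (y · w)) ++_) (trans (cong₂ _⊕_ (·-zeroʳ x) (·-zeroʳ y)) (⊕-identityˡ 𝟎))))

-- Decompositions into triangles

Finite : Set → Set
Finite A = ∃ λ k → A ↔ Fin k

finite-Fin : ∀ k → Finite (Fin k)
finite-Fin k = k , ↔-refl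

finite-⊥ : Finite ⊥
finite-⊥ = 0 , ↔-sym 0↔⊥

finite-Bool : Finite Bool
finite-Bool = 2 , ↔-sym 2↔Bool

finite-↔ : ∀ {A B} → A ↔ B → Finite B → Finite A
finite-↔ A↔B (k , B↔k) = k , ↔-trans A↔B B↔k

finite-× : ∀ {A B} → Finite A → Finite B → Finite (A × B)
finite-× (k , A↔k) (l , B↔l) = k * l , ↔-trans (A↔k ×-↔ B↔l) (↔-sym *↔×)

finite-⊎ : ∀ {A B} → Finite A → Finite B → Finite (A ⊎ B)
finite-⊎ (k , A↔k) (l , B↔l) = k + l , ↔-trans (A↔k ⊎-↔ B↔l) (↔-sym +↔⊎)

finite-V : ∀ n → Finite (V n)
finite-V zero    = 1 , mk↔ₛ′ (λ _ → Fin.zero) (λ _ → []) (λ { Fin.zero → refl ; (Fin.suc ()) }) (λ { [] → refl })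
finite-V (suc n) = finite-↔ ∷-↔ (finite-× finite-Bool (finite-V n))
  where
  ∷-↔ : V (suc n) ↔ (Bool × V n)
  ∷-↔ = mk↔ₛ′ (λ { (x ∷ v) → x , v }) (λ { (x , v) → x ∷ v }) (λ { (x , v) → refl }) (λ { (x ∷ v) → refl })

LinePredicate : ℕ → Set₁
LinePredicate N = V N → V N → Set

Holds : ∀ {N} → LinePredicate N → Sub2 N → Set
Holds P U = P (Sub2.u U) (Sub2.w U)

record Decomposition {N : ℕ} (P : LinePredicate N) (I : Set) : Set where
  field
    triangle : I → Triangle N
    sound    : ∀ U i → U ∈T triangle i → Holds P U
    complete : ∀ U → Holds P U → ∃ λ i → U ∈T triangle i
    unique   : ∀ U i j → U ∈T triangle i → U ∈T triangle j → i ≡ j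

open Decomposition

Decomposable : ∀ {N} → LinePredicate N → Set₁
Decomposable P = Σ Set λ I → Finite I × Decomposition P I

AllLines : ∀ {N} → LinePredicate N
AllLines _ _ = ⊤

decomposable⇒design : ∀ {N} → Decomposable {N} AllLines → HasTriangleDesign N
decomposable⇒design (I , (k , I↔k) , D) = k , triangle D ∘ from , λ U → covered U , unique′ U
  where
  open Inverse I↔k
  covered : ∀ U → ∃ λ j → U ∈T triangle D (from j)
  covered U with complete D U tt
  ... | i , U∈ = to i , subst (λ i′ → U ∈T triangle D i′) (sym (strictlyInverseʳ i)) U∈
  unique′ : ∀ U j j′ → U ∈T triangle D (from j) → U ∈T triangle D (from j′) → j ≡ j′
  unique′ U j j′ U∈ U∈′ =
    trans (sym (strictlyInverseˡ j)) (trans (cong to (unique D U _ _ U∈ U∈′)) (strictlyInverseˡ j′))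

design⇒decomposable : ∀ {N} → HasTriangleDesign N → Decomposable {N} AllLines
design⇒decomposable (k , T , design) = Fin k , finite-Fin k , record
  { triangle = T
  ; sound    = λ _ _ _ → tt
  ; complete = λ U _ → proj₁ (design U)
  ; unique   = λ U → proj₂ (design U) }

module _ {N : ℕ} {P Q : LinePredicate N} where

  decomposition-⇔ : ∀ {I} → (∀ U → Holds P U ⇔ Holds Q U) → Decomposition P I → Decomposition Q I
  decomposition-⇔ P⇔Q D = record
    { triangle = triangle D
    ; sound    = λ U i U∈ → Equivalence.to (P⇔Q U) (sound D U i U∈)
    ; complete = λ U q → complete D U (Equivalence.from (P⇔Q U) q)
    ; unique   = unique D }

  decomposition-⊎ : ∀ {I J} → Decomposition P I → Decomposition Q J → (∀ U → Holds P U → ¬ Holds Q U) →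
    Decomposition (λ u w → P u w ⊎ Q u w) (I ⊎ J)
  decomposition-⊎ D E disjoint = record
    { triangle = Sum.[ triangle D , triangle E ]
    ; sound    = λ { U (inj₁ i) U∈ → inj₁ (sound D U i U∈) ; U (inj₂ j) U∈ → inj₂ (sound E U j U∈) }
    ; complete = λ { U (inj₁ p) → Prod.map inj₁ id (complete D U p) ; U (inj₂ q) → Prod.map inj₂ id (complete E U q) }
    ; unique   = unique′ }
    where
    unique′ : ∀ U k l → U ∈T Sum.[ triangle D , triangle E ] k → U ∈T Sum.[ triangle D , triangle E ] l → k ≡ l
    unique′ U (inj₁ i) (inj₁ j) U∈ U∈′ = cong inj₁ (unique D U i j U∈ U∈′)
    unique′ U (inj₂ i) (inj₂ j) U∈ U∈′ = cong inj₂ (unique E U i j U∈ U∈′)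
    unique′ U (inj₁ i) (inj₂ j) U∈ U∈′ = ⊥-elim (disjoint U (sound D U i U∈) (sound E U j U∈′))
    unique′ U (inj₂ i) (inj₁ j) U∈ U∈′ = ⊥-elim (disjoint U (sound D U j U∈′) (sound E U i U∈))

decomposition-Σ : ∀ {N A J} {Q : A → LinePredicate N} → (∀ p → Decomposition (Q p) J) →
  (∀ U p q → Holds (Q p) U → Holds (Q q) U → p ≡ q) → Decomposition (λ u w → ∃ λ p → Q p u w) (A × J)
decomposition-Σ D disjoint = record
  { triangle = λ (p , j) → triangle (D p) j
  ; sound    = λ U (p , j) U∈ → p , sound (D p) U j U∈
  ; complete = λ U (p , q) → Prod.map (p ,_) id (complete (D p) U q)
  ; unique   = unique′ }
  where
  unique′ : ∀ U k l → U ∈T triangle (D (proj₁ k)) (proj₂ k) → U ∈T triangle (D (proj₁ l)) (proj₂ l) → k ≡ l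
  unique′ U (p , i) (q , j) U∈ U∈′ with disjoint U p q (sound (D p) U i U∈) (sound (D q) U j U∈′)
  ... | refl = cong (p ,_) (unique (D p) U i j U∈ U∈′)

decomposable-⊎ : ∀ {N} {P Q : LinePredicate N} → Decomposable P → Decomposable Q → (∀ U → Holds P U → ¬ Holds Q U) →
  Decomposable (λ u w → P u w ⊎ Q u w)
decomposable-⊎ (I , I-finite , D) (J , J-finite , E) disjoint =
  (I ⊎ J) , finite-⊎ I-finite J-finite , decomposition-⊎ D E disjoint

decomposable-⇔ : ∀ {N} {P Q : LinePredicate N} → (∀ U → Holds P U ⇔ Holds Q U) → Decomposable P → Decomposable Q
decomposable-⇔ P⇔Q (I , finite , D) = I , finite , decomposition-⇔ P⇔Q D

module Image {N M : ℕ} (f : V N → V M) (g : V M → V N)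
             (f-linear : IsLinear f) (g-linear : IsLinear g) (g∘f : ∀ v → g (f v) ≡ v) where

  mapTriangle : Triangle N → Triangle M
  mapTriangle (tri a b c ind) = tri (f a) (f b) (f c) (injective-linear-preserves-Indep₃ f-linear f-injective ind)
    where
    f-injective : ∀ v → f v ≡ 𝟎 → v ≡ 𝟎
    f-injective v fv≡𝟎 = trans (sym (g∘f v)) (trans (cong g fv≡𝟎) (linear-𝟎 g-linear))

  InRange : V M → Set
  InRange u = f (g u) ≡ u

  preimage : (U : Sub2 M) → InRange (Sub2.u U) → InRange (Sub2.w U) → Sub2 N
  preimage (sub2 u w ind) fgu≡u fgw≡w =
    sub2 (g u) (g w) (linear-reflects-Indep₂ f-linear (subst₂ Indep₂ (sym fgu≡u) (sym fgw≡w) ind))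

  private
    ∈⟨⟩-InRange : ∀ {v a b} → v ∈⟨ f a , f b ⟩ → InRange v
    ∈⟨⟩-InRange {a = a} {b} (x , y , refl) =
      trans (cong (f ∘ g) (sym (f-linear x y a b))) (trans (cong f (g∘f _)) (f-linear x y a b))

    ≈-InRange : ∀ {u w a b} → ⟨ u , w ⟩≈⟨ f a , f b ⟩ → InRange u × InRange w
    ≈-InRange S = Prod.map ∈⟨⟩-InRange ∈⟨⟩-InRange (≈⇒∈ S)

    ≈-preimage : ∀ {u w a b} → ⟨ u , w ⟩≈⟨ f a , f b ⟩ → ⟨ g u , g w ⟩≈⟨ a , b ⟩
    ≈-preimage {u} {w} {a} {b} S = subst₂ (⟨ g u , g w ⟩≈⟨_,_⟩) (g∘f a) (g∘f b) (linear-≈ g-linear S)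

    ≈-image : ∀ {u w a b} → InRange u → InRange w → ⟨ g u , g w ⟩≈⟨ a , b ⟩ → ⟨ u , w ⟩≈⟨ f a , f b ⟩
    ≈-image {a = a} {b} fgu≡u fgw≡w S = subst₂ (⟨_,_⟩≈⟨ f a , f b ⟩) fgu≡u fgw≡w (linear-≈ f-linear S)

  ∈mapTriangle⇒InRange : ∀ T U → U ∈T mapTriangle T → InRange (Sub2.u U) × InRange (Sub2.w U)
  ∈mapTriangle⇒InRange (tri a b c _) U = Sum.[ ≈-InRange , Sum.[ ≈-InRange , ≈-InRange ] ]

  ∈mapTriangle⇒∈preimage : ∀ T U fgu≡u fgw≡w → U ∈T mapTriangle T → preimage U fgu≡u fgw≡w ∈T T
  ∈mapTriangle⇒∈preimage (tri a b c _) U _ _ = ∈△-map ≈-preimage ≈-preimage ≈-preimage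

  ∈preimage⇒∈mapTriangle : ∀ T U fgu≡u fgw≡w → preimage U fgu≡u fgw≡w ∈T T → U ∈T mapTriangle T
  ∈preimage⇒∈mapTriangle (tri a b c _) U fgu≡u fgw≡w =
    ∈△-map (≈-image fgu≡u fgw≡w) (≈-image fgu≡u fgw≡w) (≈-image fgu≡u fgw≡w)

  image : ∀ {P I} → Decomposition P I → Decomposition (λ u w → InRange u × InRange w × P (g u) (g w)) I
  image D = record
    { triangle = mapTriangle ∘ triangle D
    ; sound    = λ U i U∈ → let fgu≡u , fgw≡w = ∈mapTriangle⇒InRange (triangle D i) U U∈ in
                   fgu≡u , fgw≡w ,
                   sound D (preimage U fgu≡u fgw≡w) i (∈mapTriangle⇒∈preimage (triangle D i) U fgu≡u fgw≡w U∈)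
    ; complete = λ U (fgu≡u , fgw≡w , p) → let i , U′∈ = complete D (preimage U fgu≡u fgw≡w) p in
                   i , ∈preimage⇒∈mapTriangle (triangle D i) U fgu≡u fgw≡w U′∈
    ; unique   = λ U i j U∈ U∈′ → let fgu≡u , fgw≡w = ∈mapTriangle⇒InRange (triangle D i) U U∈ in
                   unique D (preimage U fgu≡u fgw≡w) i j (∈mapTriangle⇒∈preimage (triangle D i) U fgu≡u fgw≡w U∈)
                                                         (∈mapTriangle⇒∈preimage (triangle D j) U fgu≡u fgw≡w U∈′) }

-- Lifting along the projection F₂ᵐ⁺ⁿ → F₂ⁿ

Indep₂-++ : ∀ {m n} {s t : V m} {a b : V n} → Indep₂ a b → Indep₂ (s ++ a) (t ++ b)
Indep₂-++ {m} {s = s} {t} {a} {b} ind =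
  linear-reflects-Indep₂ (drop-linear m) (subst₂ Indep₂ (sym (drop-++ s a)) (sym (drop-++ t b)) ind)

Indep₃-++ : ∀ {m n} {s t r : V m} {a b c : V n} → Indep₃ a b c → Indep₃ (s ++ a) (t ++ b) (r ++ c)
Indep₃-++ {m} {s = s} {t} {r} {a} {b} {c} ind = linear-reflects-Indep₃ (drop-linear m)
  (subst₂ (λ a′ b′ → Indep₃ a′ b′ (drop m (r ++ c))) (sym (drop-++ s a)) (sym (drop-++ t b))
    (subst (Indep₃ a b) (sym (drop-++ r c)) ind))

module Lift (m : ℕ) {n : ℕ} where

  LiftOf : LinePredicate n → LinePredicate (m + n)
  LiftOf L u w = Indep₂ (drop m u) (drop m w) × L (drop m u) (drop m w)

  -- On the three sides the pairs of lifting parameters are (s , t), (t , s ⊕ t) and (s ⊕ t , s);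
  -- each determines (s , t), so a lift of a side of T lies in exactly one of these triangles.
  liftTriangle : Triangle n → V m → V m → Triangle (m + n)
  liftTriangle (tri a b c ind) s t = tri (s ++ a) (t ++ b) ((s ⊕ t) ++ c) (Indep₃-++ ind)

  project : (U : Sub2 (m + n)) → Indep₂ (drop m (Sub2.u U)) (drop m (Sub2.w U)) → Sub2 n
  project U ind = sub2 (drop m (Sub2.u U)) (drop m (Sub2.w U)) ind

  private
    ≈-drop : ∀ {u w : V (m + n)} {s t : V m} {a b : V n} →
      ⟨ u , w ⟩≈⟨ s ++ a , t ++ b ⟩ → ⟨ drop m u , drop m w ⟩≈⟨ a , b ⟩
    ≈-drop {u} {w} {s} {t} {a} {b} S =
      subst₂ (⟨ drop m u , drop m w ⟩≈⟨_,_⟩) (drop-++ s a) (drop-++ t b) (linear-≈ (drop-linear m) S)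

    ∈lift⇒∈△ : ∀ {u w : V (m + n)} {a b c : V n} {s t : V m} →
      ⟨ u , w ⟩∈△⟨ s ++ a , t ++ b , (s ⊕ t) ++ c ⟩ → ⟨ drop m u , drop m w ⟩∈△⟨ a , b , c ⟩
    ∈lift⇒∈△ = ∈△-map ≈-drop ≈-drop ≈-drop

    lift-point : ∀ {u w : V (m + n)} {v : V n} → v ∈⟨ drop m u , drop m w ⟩ → ∃ λ s → (s ++ v) ∈⟨ u , w ⟩
    lift-point {u} {w} (x , y , refl) = take m ((x · u) ⊕ (y · w)) , x , y ,
      trans (cong (take m ((x · u) ⊕ (y · w)) ++_) (sym (drop-linear m x y u w))) (take++drop≡id m _)

    lift-≈ : ∀ {u w : V (m + n)} {a b : V n} → ⟨ drop m u , drop m w ⟩≈⟨ a , b ⟩ → Indep₂ a b →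
      ∃ λ (s : V m) → ∃ λ (t : V m) → ⟨ u , w ⟩≈⟨ s ++ a , t ++ b ⟩
    lift-≈ S ind with ≈⇒∈ (≈-sym S)
    ... | a∈ , b∈ with lift-point a∈ | lift-point b∈
    ... | s , sa∈ | t , tb∈ = s , t , Indep₂⇒≈ sa∈ tb∈ (Indep₂-++ ind)

    lift-unique₁ : ∀ {u w : V (m + n)} (s t s′ t′ : V m) {a b : V n} →
      ⟨ u , w ⟩≈⟨ s ++ a , t ++ b ⟩ → ⟨ u , w ⟩≈⟨ s′ ++ a , t′ ++ b ⟩ → Indep₂ a b → s ≡ s′
    lift-unique₁ s t s′ t′ {a} {b} S S′ ind
      with proj₁ (≈⇒∈ (≈-trans (≈-sym S) S′))
    ... | x , y , e with ++-injective s ((x · s′) ⊕ (y · t′)) (trans e (++-lincomb x y s′ t′ a b))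
    ... | s≡ , a≡ with Indep₂-coefficients ind (trans (lincomb-10 a b) a≡)
    ... | refl , refl = trans s≡ (lincomb-10 s′ t′)

    lift-unique : ∀ {u w : V (m + n)} (s t s′ t′ : V m) {a b : V n} →
      ⟨ u , w ⟩≈⟨ s ++ a , t ++ b ⟩ → ⟨ u , w ⟩≈⟨ s′ ++ a , t′ ++ b ⟩ → Indep₂ a b → s ≡ s′ × t ≡ t′
    lift-unique s t s′ t′ S S′ ind =
      lift-unique₁ s t s′ t′ S S′ ind , lift-unique₁ t s t′ s′ (≈-trans S ≈-swap) (≈-trans S′ ≈-swap) (Indep₂-sym ind)

  ∈liftTriangle⇒Indep₂ : ∀ T U s t → U ∈T liftTriangle T s t → Indep₂ (drop m (Sub2.u U)) (drop m (Sub2.w U))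
  ∈liftTriangle⇒Indep₂ (tri a b c ind) U s t U∈ = ∈△⇒Indep₂ ind (∈lift⇒∈△ U∈)

  ∈liftTriangle⇒∈project : ∀ T U s t ind → U ∈T liftTriangle T s t → project U ind ∈T T
  ∈liftTriangle⇒∈project (tri a b c _) U s t _ = ∈lift⇒∈△

  ∈project⇒∈liftTriangle : ∀ T U ind → project U ind ∈T T → ∃ λ ((s , t) : V m × V m) → U ∈T liftTriangle T s t
  ∈project⇒∈liftTriangle (tri a b c ind) U _ (inj₁ S) with lift-≈ S (Indep₃⇒Indep₂ ind)
  ... | s , t , S′ = (s , t) , inj₁ S′
  ∈project⇒∈liftTriangle (tri a b c ind) U _ (inj₂ (inj₁ S)) with lift-≈ S (Indep₃⇒Indep₂ᵇᶜ ind)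
  ... | t , r , S′ = (r ⊕ t , t) , inj₂ (inj₁ (subst (λ z → ⟨ _ , _ ⟩≈⟨ t ++ b , z ++ c ⟩) (sym (⊕-cancelʳ r t)) S′))
  ∈project⇒∈liftTriangle (tri a b c ind) U _ (inj₂ (inj₂ S)) with lift-≈ S (Indep₃⇒Indep₂ᶜᵃ ind)
  ... | r , s , S′ = (s , s ⊕ r) , inj₂ (inj₂ (subst (λ z → ⟨ _ , _ ⟩≈⟨ z ++ c , s ++ a ⟩) (sym (⊕-cancelˡ s r)) S′))

  liftTriangle-unique : ∀ T U s t s′ t′ → U ∈T liftTriangle T s t → U ∈T liftTriangle T s′ t′ → (s , t) ≡ (s′ , t′)
  liftTriangle-unique (tri a b c ind) U s t s′ t′ (inj₁ S) (inj₁ S′) =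
    let s≡s′ , t≡t′ = lift-unique s t s′ t′ S S′ (Indep₃⇒Indep₂ ind) in cong₂ _,_ s≡s′ t≡t′
  liftTriangle-unique (tri a b c ind) U s t s′ t′ (inj₂ (inj₁ S)) (inj₂ (inj₁ S′)) =
    let t≡t′ , s⊕t≡s′⊕t′ = lift-unique t (s ⊕ t) t′ (s′ ⊕ t′) S S′ (Indep₃⇒Indep₂ᵇᶜ ind) in
    cong₂ _,_ (⊕-injectiveˡ t (trans s⊕t≡s′⊕t′ (cong (s′ ⊕_) (sym t≡t′)))) t≡t′
  liftTriangle-unique (tri a b c ind) U s t s′ t′ (inj₂ (inj₂ S)) (inj₂ (inj₂ S′)) =
    let s⊕t≡s′⊕t′ , s≡s′ = lift-unique (s ⊕ t) s (s′ ⊕ t′) s′ S S′ (Indep₃⇒Indep₂ᶜᵃ ind) in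
    cong₂ _,_ s≡s′ (⊕-injectiveʳ s (trans s⊕t≡s′⊕t′ (cong (_⊕ t′) (sym s≡s′))))
  liftTriangle-unique (tri a b c ind) U s t s′ t′ (inj₁ S) (inj₂ (inj₁ S′)) =
    ⊥-elim (sides-distinct ind (≈-drop S) (≈-drop S′))
  liftTriangle-unique (tri a b c ind) U s t s′ t′ (inj₂ (inj₁ S)) (inj₁ S′) =
    ⊥-elim (sides-distinct ind (≈-drop S′) (≈-drop S))
  liftTriangle-unique (tri a b c ind) U s t s′ t′ (inj₂ (inj₁ S)) (inj₂ (inj₂ S′)) =
    ⊥-elim (sides-distinct (Indep₃-rotate ind) (≈-drop S) (≈-drop S′))
  liftTriangle-unique (tri a b c ind) U s t s′ t′ (inj₂ (inj₂ S)) (inj₂ (inj₁ S′)) =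
    ⊥-elim (sides-distinct (Indep₃-rotate ind) (≈-drop S′) (≈-drop S))
  liftTriangle-unique (tri a b c ind) U s t s′ t′ (inj₂ (inj₂ S)) (inj₁ S′) =
    ⊥-elim (sides-distinct (Indep₃-rotate (Indep₃-rotate ind)) (≈-drop S) (≈-drop S′))
  liftTriangle-unique (tri a b c ind) U s t s′ t′ (inj₁ S) (inj₂ (inj₂ S′)) =
    ⊥-elim (sides-distinct (Indep₃-rotate (Indep₃-rotate ind)) (≈-drop S′) (≈-drop S))

  lift : ∀ {L I} → Decomposition L I → Decomposition (LiftOf L) (I × V m × V m)
  lift D = record
    { triangle = λ (i , s , t) → liftTriangle (triangle D i) s t
    ; sound    = λ U (i , s , t) U∈ → let ind = ∈liftTriangle⇒Indep₂ (triangle D i) U s t U∈ in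
                   ind , sound D (project U ind) i (∈liftTriangle⇒∈project (triangle D i) U s t ind U∈)
    ; complete = λ U (ind , l) → let i , U′∈ = complete D (project U ind) l
                                     (s , t) , U∈ = ∈project⇒∈liftTriangle (triangle D i) U ind U′∈ in
                   (i , s , t) , U∈
    ; unique   = unique′ }
    where
    unique′ : ∀ U k l → U ∈T liftTriangle (triangle D (proj₁ k)) (proj₁ (proj₂ k)) (proj₂ (proj₂ k)) →
                        U ∈T liftTriangle (triangle D (proj₁ l)) (proj₁ (proj₂ l)) (proj₂ (proj₂ l)) → k ≡ l
    unique′ U (i , s , t) (j , s′ , t′) U∈ U∈′
      with ind ← ∈liftTriangle⇒Indep₂ (triangle D i) U s t U∈
      with refl ← unique D (project U ind) i j (∈liftTriangle⇒∈project (triangle D i) U s t ind U∈)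
                                               (∈liftTriangle⇒∈project (triangle D j) U s′ t′ ind U∈′)
      with refl ← liftTriangle-unique (triangle D i) U s t s′ t′ U∈ U∈′
      = refl

-- Lines with a one-dimensional projection

𝟏 : V 1
𝟏 = true ∷ []

𝟎≢𝟏 : 𝟎 ≢ 𝟏
𝟎≢𝟏 ()

OffHyperplane : ∀ m → LinePredicate (m + 1)
OffHyperplane m u w = drop m u ≡ 𝟏 ⊎ drop m w ≡ 𝟏

_∈⟨_⟩₁ : ∀ {n} → V n → V n → Set
v ∈⟨ b ⟩₁ = v ≡ 𝟎 ⊎ v ≡ b

⟨_,_⟩=⟨_⟩ : ∀ {n} → V n → V n → V n → Set
⟨ u , w ⟩=⟨ b ⟩ = u ∈⟨ b ⟩₁ × w ∈⟨ b ⟩₁ × (u ≡ b ⊎ w ≡ b)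

span-trichotomy : ∀ {n} (u w : V n) → (u ≡ 𝟎 × w ≡ 𝟎) ⊎ Indep₂ u w ⊎ ∃ λ b → b ≢ 𝟎 × ⟨ u , w ⟩=⟨ b ⟩
span-trichotomy u w with u ≟ᵥ 𝟎 | w ≟ᵥ 𝟎 | u ≟ᵥ w
... | yes u≡𝟎 | yes w≡𝟎 | _       = inj₁ (u≡𝟎 , w≡𝟎)
... | yes u≡𝟎 | no  w≢𝟎 | _       = inj₂ (inj₂ (w , w≢𝟎 , inj₁ u≡𝟎 , inj₂ refl , inj₂ refl))
... | no  u≢𝟎 | yes w≡𝟎 | _       = inj₂ (inj₂ (u , u≢𝟎 , inj₂ refl , inj₁ w≡𝟎 , inj₁ refl))
... | no  u≢𝟎 | no  _   | yes u≡w = inj₂ (inj₂ (u , u≢𝟎 , inj₂ refl , inj₂ (sym u≡w) , inj₁ refl))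
... | no  u≢𝟎 | no  w≢𝟎 | no  u≢w = inj₂ (inj₁ (≢⇒Indep₂ u≢𝟎 w≢𝟎 u≢w))

¬Indep₂-in-line : ∀ {n} {u w b : V n} → ⟨ u , w ⟩=⟨ b ⟩ → ¬ Indep₂ u w
¬Indep₂-in-line (inj₁ u≡𝟎 , _ , _)                 ind = Indep₂⇒≢𝟎ˡ ind u≡𝟎
¬Indep₂-in-line (inj₂ _ , inj₁ w≡𝟎 , _)            ind = Indep₂⇒≢𝟎ʳ ind w≡𝟎
¬Indep₂-in-line (inj₂ u≡b , inj₂ w≡b , _)          ind = Indep₂⇒≢ ind (trans u≡b (sym w≡b))

line-unique : ∀ {n} {u w b b′ : V n} → b ≢ 𝟎 → ⟨ u , w ⟩=⟨ b ⟩ → ⟨ u , w ⟩=⟨ b′ ⟩ → b ≡ b′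
line-unique b≢𝟎 (_ , _ , inj₁ u≡b) (inj₁ u≡𝟎 , _ , _)  = ⊥-elim (b≢𝟎 (trans (sym u≡b) u≡𝟎))
line-unique b≢𝟎 (_ , _ , inj₁ u≡b) (inj₂ u≡b′ , _ , _) = trans (sym u≡b) u≡b′
line-unique b≢𝟎 (_ , _ , inj₂ w≡b) (_ , inj₁ w≡𝟎 , _)  = ⊥-elim (b≢𝟎 (trans (sym w≡b) w≡𝟎))
line-unique b≢𝟎 (_ , _ , inj₂ w≡b) (_ , inj₂ w≡b′ , _) = trans (sym w≡b) w≡b′

scale : ∀ {n} → V n → V 1 → V n
scale b (r ∷ []) = r · b

scale-∈⟨⟩₁ : ∀ {n} (b : V n) r → scale b r ∈⟨ b ⟩₁
scale-∈⟨⟩₁ b (false ∷ []) = inj₁ (·-zeroˡ b)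
scale-∈⟨⟩₁ b (true  ∷ []) = inj₂ (·-identity b)

scale-linear : ∀ {n} (b : V n) → IsLinear (scale b)
scale-linear b x y (r ∷ []) (s ∷ []) = begin
  ((x ∧ r) xor (y ∧ s)) · b          ≡⟨ ·-distribʳ-xor (x ∧ r) (y ∧ s) b ⟩
  ((x ∧ r) · b) ⊕ ((y ∧ s) · b)      ≡⟨ sym (cong₂ _⊕_ (·-assoc x r b) (·-assoc y s b)) ⟩
  (x · (r · b)) ⊕ (y · (s · b))      ∎
  where open ≡-Reasoning

-- The functional dual p makes (x , y) ↦ (x , dual p y) a linear retraction of the embedding
-- F₂ᵐ⁺¹ ≅ F₂ᵐ ⊕ ⟨ vector p ⟩ ⊆ F₂ᵐ⁺ⁿ.
record Directions (n : ℕ) : Set₁ where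
  field
    Point            : Set
    finite           : Finite Point
    vector           : Point → V n
    dual             : Point → V n → V 1
    dual-linear      : ∀ p → IsLinear (dual p)
    dual-vector      : ∀ p → dual p (vector p) ≡ 𝟏
    vector-injective : ∀ {p q} → vector p ≡ vector q → p ≡ q

  vector≢𝟎 : ∀ p → vector p ≢ 𝟎
  vector≢𝟎 p vector≡𝟎 =
    𝟎≢𝟏 (trans (sym (linear-𝟎 (dual-linear p))) (trans (cong (dual p) (sym vector≡𝟎)) (dual-vector p)))

  dual∘scale : ∀ p r → dual p (scale (vector p) r) ≡ r
  dual∘scale p (r ∷ []) =
    trans (linear-· (dual-linear p) r (vector p)) (trans (cong (r ·_) (dual-vector p)) (cong (_∷ []) (∧-identityʳ r)))

  scale∘dual : ∀ p {v} → v ∈⟨ vector p ⟩₁ → scale (vector p) (dual p v) ≡ v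
  scale∘dual p (inj₁ refl) = trans (cong (scale (vector p)) (linear-𝟎 (dual-linear p))) (·-zeroˡ (vector p))
  scale∘dual p (inj₂ refl) = trans (cong (scale (vector p)) (dual-vector p)) (·-identity (vector p))

  dual≡𝟏⇒≡vector : ∀ p {v} → v ∈⟨ vector p ⟩₁ → dual p v ≡ 𝟏 → v ≡ vector p
  dual≡𝟏⇒≡vector p (inj₁ refl) dual𝟎≡𝟏 = ⊥-elim (𝟎≢𝟏 (trans (sym (linear-𝟎 (dual-linear p))) dual𝟎≡𝟏))
  dual≡𝟏⇒≡vector p (inj₂ refl) _        = refl

module OneDimensional (m : ℕ) {n : ℕ} (dirs : Directions n) where
  open Directions dirs

  ProjectsOnto : Point → LinePredicate (m + n)
  ProjectsOnto p u w = ⟨ drop m u , drop m w ⟩=⟨ vector p ⟩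

  NonzeroProjection : LinePredicate n → LinePredicate (m + n)
  NonzeroProjection L u w = Lift.LiftOf m L u w ⊎ ∃ λ p → ProjectsOnto p u w

  embedAlong : Point → V (m + 1) → V (m + n)
  embedAlong p = id ⊞ scale (vector p)

  retractAlong : Point → V (m + n) → V (m + 1)
  retractAlong p = id ⊞ dual p

  module Along (p : Point) = Image (embedAlong p) (retractAlong p)
    (⊞-linear {f = id} id-linear (scale-linear (vector p))) (⊞-linear {f = id} id-linear (dual-linear p))
    (⊞-inverse {f = id} {g = scale (vector p)} {f′ = id} {g′ = dual p} (λ _ → refl) (dual∘scale p))

  private
    embed∘retract : ∀ p u → embedAlong p (retractAlong p u) ≡ take m u ++ scale (vector p) (dual p (drop m u))
    embed∘retract p u = let take≡ , drop≡ = take-drop-++ (take m u) (dual p (drop m u)) in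
      cong₂ _++_ take≡ (cong (scale (vector p)) drop≡)

    InRange⇔ : ∀ p u → Along.InRange p u ⇔ drop m u ∈⟨ vector p ⟩₁
    InRange⇔ p u = mk⇔
      (λ fixed → subst (_∈⟨ vector p ⟩₁)
        (++-injectiveʳ (take m u) (take m u) (trans (sym (embed∘retract p u)) (trans fixed (sym (take++drop≡id m u)))))
        (scale-∈⟨⟩₁ (vector p) (dual p (drop m u))))
      (λ u′∈ → trans (embed∘retract p u) (trans (cong (take m u ++_) (scale∘dual p u′∈)) (take++drop≡id m u)))

    drop∘retract : ∀ p u → drop m (retractAlong p u) ≡ dual p (drop m u)
    drop∘retract p u = drop-++ (take m u) (dual p (drop m u))

    image⇔ProjectsOnto : ∀ p (U : Sub2 (m + n)) →
      Holds (λ u w → Along.InRange p u × Along.InRange p w × OffHyperplane m (retractAlong p u) (retractAlong p w)) U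
        ⇔ Holds (ProjectsOnto p) U
    image⇔ProjectsOnto p (sub2 u w _) = mk⇔
      (λ (fixed-u , fixed-w , off) → let u′∈ = Equivalence.to (InRange⇔ p u) fixed-u
                                         w′∈ = Equivalence.to (InRange⇔ p w) fixed-w in
        u′∈ , w′∈ , Sum.map (dual≡𝟏⇒≡vector p u′∈ ∘ trans (sym (drop∘retract p u)))
                            (dual≡𝟏⇒≡vector p w′∈ ∘ trans (sym (drop∘retract p w))) off)
      (λ (u′∈ , w′∈ , on) → Equivalence.from (InRange⇔ p u) u′∈ , Equivalence.from (InRange⇔ p w) w′∈ ,
        Sum.map (λ u′≡ → trans (drop∘retract p u) (trans (cong (dual p) u′≡) (dual-vector p)))
                (λ w′≡ → trans (drop∘retract p w) (trans (cong (dual p) w′≡) (dual-vector p))) on)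

  oneDimensional : ∀ {J} → Decomposition (OffHyperplane m) J →
    Decomposition (λ u w → ∃ λ p → ProjectsOnto p u w) (Point × J)
  oneDimensional R = decomposition-Σ (λ p → decomposition-⇔ (image⇔ProjectsOnto p) (Along.image p R))
    (λ U p q on-p on-q → vector-injective (line-unique (vector≢𝟎 p) on-p on-q))

  combine : ∀ {L} → Decomposable L → Decomposable (OffHyperplane m) → Decomposable (NonzeroProjection L)
  combine (I , I-finite , D) (J , J-finite , R) =
    ((I × V m × V m) ⊎ (Point × J)) ,
    finite-⊎ (finite-× I-finite (finite-× (finite-V m) (finite-V m))) (finite-× finite J-finite) ,
    decomposition-⊎ (Lift.lift m D) (oneDimensional R) (λ U (ind , _) (_ , on) → ¬Indep₂-in-line on ind)

-- Lines off a hyperplane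

lastCoordinateDirections : ∀ d → Directions (d + 1)
lastCoordinateDirections d = record
  { Point            = V d
  ; finite           = finite-V d
  ; vector           = _++ 𝟏
  ; dual             = λ _ → drop d
  ; dual-linear      = λ _ → drop-linear d
  ; dual-vector      = λ x → drop-++ x 𝟏
  ; vector-injective = ++-injectiveˡ _ _ }

module _ {P : Bool → Set} (P? : ∀ x → Dec (P x)) where

  all-Bool? : Dec (∀ x → P x)
  all-Bool? = map′ (λ (t , f) → λ { true → t ; false → f }) (λ h → h true , h false) (P? true ×-dec P? false)

  any-Bool? : Dec (∃ P)
  any-Bool? = map′ Sum.[ (true ,_) , (false ,_) ] (λ { (true , p) → inj₁ p ; (false , p) → inj₂ p })
                   (P? true ⊎-dec P? false)

all-V? : ∀ n {P : V n → Set} → (∀ v → Dec (P v)) → Dec (∀ v → P v)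
all-V? zero    P? = map′ (λ p → λ { [] → p }) (λ h → h []) (P? [])
all-V? (suc n) P? = map′ (λ h → λ { (x ∷ v) → h x v }) (λ h x v → h (x ∷ v)) (all-Bool? λ x → all-V? n λ v → P? (x ∷ v))

module _ {n : ℕ} where

  _∈⟨_,_⟩? : (v a b : V n) → Dec (v ∈⟨ a , b ⟩)
  v ∈⟨ a , b ⟩? = any-Bool? λ x → any-Bool? λ y → v ≟ᵥ ((x · a) ⊕ (y · b))

  ⟨_,_⟩≈⟨_,_⟩? : (u w a b : V n) → Dec (⟨ u , w ⟩≈⟨ a , b ⟩)
  ⟨ u , w ⟩≈⟨ a , b ⟩? = map′ (λ ((u∈ , w∈) , (a∈ , b∈)) → ≈-intro u∈ w∈ a∈ b∈) (λ S → ≈⇒∈ S , ≈⇒∈ (≈-sym S))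
    ((u ∈⟨ a , b ⟩? ×-dec w ∈⟨ a , b ⟩?) ×-dec (a ∈⟨ u , w ⟩? ×-dec b ∈⟨ u , w ⟩?))

  ⟨_,_⟩∈△⟨_,_,_⟩? : (u w a b c : V n) → Dec (⟨ u , w ⟩∈△⟨ a , b , c ⟩)
  ⟨ u , w ⟩∈△⟨ a , b , c ⟩? = ⟨ u , w ⟩≈⟨ a , b ⟩? ⊎-dec ⟨ u , w ⟩≈⟨ b , c ⟩? ⊎-dec ⟨ u , w ⟩≈⟨ c , a ⟩?

  Indep₂? : (a b : V n) → Dec (Indep₂ a b)
  Indep₂? a b = all-Bool? λ x → all-Bool? λ y →
    (((x · a) ⊕ (y · b)) ≟ᵥ 𝟎) →-dec ((x ≟ᵇ false) ×-dec (y ≟ᵇ false))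

  Indep₃? : (a b c : V n) → Dec (Indep₃ a b c)
  Indep₃? a b c = all-Bool? λ x → all-Bool? λ y → all-Bool? λ z →
    ((((x · a) ⊕ (y · b)) ⊕ (z · c)) ≟ᵥ 𝟎) →-dec ((x ≟ᵇ false) ×-dec (y ≟ᵇ false) ×-dec (z ≟ᵇ false))
decidedTriangle : ∀ {n} (a b c : V n) → {True (Indep₃? a b c)} → Triangle n
decidedTriangle a b c {indep} = tri a b c (toWitness indep)

fanoTriangle : Bool → Triangle 3
fanoTriangle true  = decidedTriangle (false ∷ false ∷ true ∷ []) (false ∷ true ∷ true ∷ []) (true ∷ false ∷ false ∷ [])
fanoTriangle false = decidedTriangle (true ∷ true ∷ true ∷ []) (true ∷ false ∷ true ∷ []) (true ∷ true ∷ false ∷ [])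

fano : Decomposition (OffHyperplane 2) Bool
fano = record
  { triangle = fanoTriangle
  ; sound    = λ U i → onSide⇒off i (Sub2.u U) (Sub2.w U)
  ; complete = λ U → off⇒onSide (Sub2.u U) (Sub2.w U) (Sub2.indep U)
  ; unique   = λ U i j → onSide-unique i j (Sub2.u U) (Sub2.w U) }
  where
  OnSide : Bool → V 3 → V 3 → Set
  OnSide i u w = let open Triangle (fanoTriangle i) in ⟨ u , w ⟩∈△⟨ a , b , c ⟩

  onSide? : ∀ i u w → Dec (OnSide i u w)
  onSide? i u w = let open Triangle (fanoTriangle i) in ⟨ u , w ⟩∈△⟨ a , b , c ⟩?

  offHyperplane? : ∀ u w → Dec (OffHyperplane 2 u w)
  offHyperplane? u w = (drop 2 u ≟ᵥ 𝟏) ⊎-dec (drop 2 w ≟ᵥ 𝟏)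

  onSide⇒off : ∀ i u w → OnSide i u w → OffHyperplane 2 u w
  onSide⇒off = from-yes (all-Bool? λ i → all-V? 3 λ u → all-V? 3 λ w → onSide? i u w →-dec offHyperplane? u w)

  off⇒onSide : ∀ u w → Indep₂ u w → OffHyperplane 2 u w → ∃ λ i → OnSide i u w
  off⇒onSide = from-yes (all-V? 3 λ u → all-V? 3 λ w →
    Indep₂? u w →-dec offHyperplane? u w →-dec any-Bool? λ i → onSide? i u w)

  onSide-unique : ∀ i j u w → OnSide i u w → OnSide j u w → i ≡ j
  onSide-unique = from-yes (all-Bool? λ i → all-Bool? λ j → all-V? 3 λ u → all-V? 3 λ w →
    onSide? i u w →-dec onSide? j u w →-dec i ≟ᵇ j)

no-lines-in-F₂ : ¬ Sub2 1
no-lines-in-F₂ (sub2 (false ∷ []) _           ind) = Indep₂⇒≢𝟎ˡ ind refl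
no-lines-in-F₂ (sub2 (true ∷ [])  (false ∷ []) ind) = Indep₂⇒≢𝟎ʳ ind refl
no-lines-in-F₂ (sub2 (true ∷ [])  (true ∷ [])  ind) = Indep₂⇒≢ ind refl

drop-𝟎 : ∀ m {n} → drop m (𝟎 {m + n}) ≡ 𝟎
drop-𝟎 m = linear-𝟎 (drop-linear m)

-- A line of F₂²⁺ᵈ⁺¹ off the hyperplane projects to F₂ᵈ⁺¹ either onto a line off the hyperplane or
-- onto ⟨ b ⟩ with b off the hyperplane, never onto 0.
offHyperplane-step : ∀ d → Decomposable (OffHyperplane d) → Decomposable (OffHyperplane (2 + d))
offHyperplane-step d R = decomposable-⇔ characterisation (combine R (Bool , finite-Bool , fano))
  where
  open OneDimensional 2 (lastCoordinateDirections d)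

  drop-2+d : ∀ (u : V (2 + (d + 1))) → drop (2 + d) u ≡ drop d (drop 2 u)
  drop-2+d (_ ∷ _ ∷ _) = refl

  off-in-line : ∀ {v b : V (d + 1)} → v ∈⟨ b ⟩₁ → drop d v ≡ 𝟏 → drop d b ≡ 𝟏
  off-in-line (inj₁ refl) drop𝟎≡𝟏 = ⊥-elim (𝟎≢𝟏 (trans (sym (drop-𝟎 d)) drop𝟎≡𝟏))
  off-in-line (inj₂ refl) drop≡𝟏 = drop≡𝟏

  characterisation : ∀ U → Holds (NonzeroProjection (OffHyperplane d)) U ⇔ Holds (OffHyperplane (2 + d)) U
  characterisation (sub2 u w _) = mk⇔ to from
    where
    on⇒off : ∀ v p → drop 2 v ≡ p ++ 𝟏 → drop (2 + d) v ≡ 𝟏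
    on⇒off v p e = trans (drop-2+d v) (trans (cong (drop d) e) (drop-++ p 𝟏))

    off-line : ∀ {b} → OffHyperplane (2 + d) u w → drop 2 u ∈⟨ b ⟩₁ → drop 2 w ∈⟨ b ⟩₁ → drop d b ≡ 𝟏
    off-line off u′∈ w′∈ =
      Sum.[ off-in-line u′∈ ∘ trans (sym (drop-2+d u)) , off-in-line w′∈ ∘ trans (sym (drop-2+d w)) ] off

    b≡take++𝟏 : ∀ {b} → drop d b ≡ 𝟏 → take d b ++ 𝟏 ≡ b
    b≡take++𝟏 {b} drop≡𝟏 = trans (cong (take d b ++_) (sym drop≡𝟏)) (take++drop≡id d b)

    to : NonzeroProjection (OffHyperplane d) u w → OffHyperplane (2 + d) u w
    to (inj₁ (_ , off))        = Sum.map (trans (drop-2+d u)) (trans (drop-2+d w)) off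
    to (inj₂ (p , _ , _ , on)) = Sum.map (on⇒off u p) (on⇒off w p) on

    from : OffHyperplane (2 + d) u w → NonzeroProjection (OffHyperplane d) u w
    from off with span-trichotomy (drop 2 u) (drop 2 w)
    ... | inj₁ (u′≡𝟎 , w′≡𝟎) = ⊥-elim (𝟎≢𝟏 (trans (sym (drop-𝟎 d)) (off-line off (inj₁ u′≡𝟎) (inj₁ w′≡𝟎))))
    ... | inj₂ (inj₁ ind)    = inj₁ (ind , Sum.map (trans (sym (drop-2+d u))) (trans (sym (drop-2+d w))) off)
    ... | inj₂ (inj₂ (b , _ , line@(u′∈ , w′∈ , _))) =
      inj₂ (take d b , subst (⟨ drop 2 u , drop 2 w ⟩=⟨_⟩) (sym (b≡take++𝟏 (off-line off u′∈ w′∈))) line)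

offHyperplane-decomposable : ∀ k → Decomposable (OffHyperplane (k * 2))
offHyperplane-decomposable zero    = ⊥ , finite-⊥ , record
  { triangle = λ () ; sound = λ _ () ; complete = λ U _ → ⊥-elim (no-lines-in-F₂ U) ; unique = λ _ () }
offHyperplane-decomposable (suc k) = offHyperplane-step (k * 2) (offHyperplane-decomposable k)

NonZeroVec : ℕ → Set
NonZeroVec zero    = ⊥
NonZeroVec (suc n) = V n ⊎ NonZeroVec n

toVec : ∀ {n} → NonZeroVec n → V n
toVec {suc n} (inj₁ v) = true ∷ v
toVec {suc n} (inj₂ p) = false ∷ toVec p

pivot : ∀ {n} → NonZeroVec n → V n → V 1
pivot {suc n} (inj₁ _) (r ∷ _) = r ∷ []
pivot {suc n} (inj₂ p) (_ ∷ v) = pivot p v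

pivot-linear : ∀ {n} (p : NonZeroVec n) → IsLinear (pivot p)
pivot-linear {suc n} (inj₁ _) x y (r ∷ u) (s ∷ w) = refl
pivot-linear {suc n} (inj₂ p) x y (r ∷ u) (s ∷ w) = pivot-linear p x y u w

pivot-toVec : ∀ {n} (p : NonZeroVec n) → pivot p (toVec p) ≡ 𝟏
pivot-toVec {suc n} (inj₁ _) = refl
pivot-toVec {suc n} (inj₂ p) = pivot-toVec p

toVec-injective : ∀ {n} {p q : NonZeroVec n} → toVec p ≡ toVec q → p ≡ q
toVec-injective {suc n} {inj₁ _} {inj₁ _} refl = refl
toVec-injective {suc n} {inj₂ p} {inj₂ q} e    = cong inj₂ (toVec-injective (∷-injectiveʳ e))

toVec-surjective : ∀ {n} (b : V n) → b ≢ 𝟎 → ∃ λ p → toVec p ≡ b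
toVec-surjective []          b≢𝟎 = ⊥-elim (b≢𝟎 refl)
toVec-surjective (true ∷ b)  _   = inj₁ b , refl
toVec-surjective (false ∷ b) b≢𝟎 = let p , e = toVec-surjective b (b≢𝟎 ∘ cong (false ∷_)) in inj₂ p , cong (false ∷_) e

finite-NonZeroVec : ∀ n → Finite (NonZeroVec n)
finite-NonZeroVec zero    = finite-⊥
finite-NonZeroVec (suc n) = finite-⊎ (finite-V n) (finite-NonZeroVec n)

nonzeroDirections : ∀ n → Directions n
nonzeroDirections n = record
  { Point            = NonZeroVec n
  ; finite           = finite-NonZeroVec n
  ; vector           = toVec
  ; dual             = pivot
  ; dual-linear      = pivot-linear
  ; dual-vector      = pivot-toVec
  ; vector-injective = toVec-injective }

design-+ : ∀ {m n} → Decomposable (OffHyperplane m) →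
  HasTriangleDesign m → HasTriangleDesign n → HasTriangleDesign (m + n)
design-+ {m} {n} R A B =
  decomposable⇒design (decomposable-⇔ characterisation (decomposable-⊎ A′ (combine (design⇒decomposable B) R) disjoint))
  where
  open OneDimensional m (nonzeroDirections n)
  open Directions (nonzeroDirections n) using (vector≢𝟎)
  module Embed = Image (embed {m} {n}) (take m) embed-linear (take-linear m) (λ v → proj₁ (take-drop-++ v 𝟎))

  InF₂ᵐ : LinePredicate (m + n)
  InF₂ᵐ u w = Embed.InRange u × Embed.InRange w × ⊤

  A′ : Decomposable InF₂ᵐ
  A′ = let I , I-finite , D = design⇒decomposable A in I , I-finite , Embed.image D

  InRange⇒drop≡𝟎 : ∀ {u} → Embed.InRange u → drop m u ≡ 𝟎
  InRange⇒drop≡𝟎 {u} fixed = trans (cong (drop m) (sym fixed)) (drop-++ (take m u) 𝟎)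

  drop≡𝟎⇒InRange : ∀ {u} → drop m u ≡ 𝟎 → Embed.InRange u
  drop≡𝟎⇒InRange {u} drop≡𝟎 = trans (cong (take m u ++_) (sym drop≡𝟎)) (take++drop≡id m u)

  disjoint : ∀ U → Holds InF₂ᵐ U → ¬ Holds (NonzeroProjection AllLines) U
  disjoint U (fixed-u , fixed-w , _) (inj₁ (ind , _)) = Indep₂⇒≢𝟎ˡ ind (InRange⇒drop≡𝟎 fixed-u)
  disjoint U (fixed-u , fixed-w , _) (inj₂ (p , _ , _ , on)) = vector≢𝟎 p
    (Sum.[ (λ u′≡ → trans (sym u′≡) (InRange⇒drop≡𝟎 fixed-u)) , (λ w′≡ → trans (sym w′≡) (InRange⇒drop≡𝟎 fixed-w)) ] on)

  characterisation : ∀ U → Holds (λ u w → InF₂ᵐ u w ⊎ NonzeroProjection AllLines u w) U ⇔ Holds AllLines U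
  characterisation (sub2 u w _) = mk⇔ (λ _ → tt) (λ _ → classify)
    where
    classify : InF₂ᵐ u w ⊎ NonzeroProjection AllLines u w
    classify with span-trichotomy (drop m u) (drop m w)
    ... | inj₁ (u′≡𝟎 , w′≡𝟎)           = inj₁ (drop≡𝟎⇒InRange u′≡𝟎 , drop≡𝟎⇒InRange w′≡𝟎 , tt)
    ... | inj₂ (inj₁ ind)               = inj₂ (inj₁ (ind , tt))
    ... | inj₂ (inj₂ (b , b≢𝟎 , line)) = let p , toVec≡b = toVec-surjective b b≢𝟎 in
      inj₂ (inj₂ (p , subst (⟨ drop m u , drop m w ⟩=⟨_⟩) (sym toVec≡b) line))

-- The construction works for m = 0 or n = 0 as well.
theorem6 : ∀ (m n : ℕ) → m ≥ 1 → n ≥ 1 → 2 ∣ m * n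
    → HasTriangleDesign m → HasTriangleDesign n → HasTriangleDesign (m + n)
theorem6 m n _ _ 2∣mn A B with euclidsLemma m n prime[2] 2∣mn
... | inj₁ (divides k refl) = design-+ (offHyperplane-decomposable k) A B
... | inj₂ (divides k refl) = subst HasTriangleDesign (+-comm n m) (design-+ (offHyperplane-decomposable k) B A)
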